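{- Let $\pi=\pi_1\pi_2\cdots\pi_n$ be a left-crucial permutation with respect to squares such that either $\pi_1<\pi_2<\pi_3$ or $\pi_1>\pi_2>\pi_3$. Then, among all $n+1$ extensions of $\pi$ to the left, there occur squares of at least four different lengths.
   Context: Permutations are written in one-line notation. A factor is a sequence of consecutive entries; two sequences of distinct numbers of equal length are order-isomorphic if their entries are in the same relative order. A square is a factor $XY$ with $X,Y$ consecutive, of equal length at least $2$, and order-isomorphic; its length is $2|X|$. A permutation is square-free if it contains no square. For $\pi=\pi_1\cdots\pi_n$ and $x\in\{1,\dots,n+1\}$, the extension of $\pi$ to the left by $x$ is the permutation $x\pi'_1\cdots\pi'_n$ where $\pi'_j=\pi_j$ if $\pi_j<x$ and $\pi'_j=\pi_j+1$ otherwise. A permutation is left-crucial with respect to squares if it is square-free but every extension of it to the left by every $x\in\{1,\dots,n+1\}$ contains a square. -}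

module Defs where

open import Data.Nat using (ℕ; zero; suc; _+_; _*_; _<_; _≤_; _<ᵇ_)
open import Data.List using (List; []; _∷_; length; take; drop; map; upTo)
open import Data.List.Relation.Binary.Permutation.Propositional using (_↭_)
open import Data.List.Relation.Unary.Unique.Propositional using (Unique)
open import Data.Maybe using (Maybe; just; nothing)
open import Data.Bool using (if_then_else_)
open import Data.Product using (Σ; _×_; ∃; ∃-syntax; _,_)
open import Function.Bundles using (_⇔_)
open import Relation.Nullary using (¬_)
open import Relation.Binary.PropositionalEquality using (_≡_)

oneTo : ℕ → List ℕ
oneTo n = map suc (upTo n)

IsPerm : ℕ → List ℕ → Set
IsPerm n π = π ↭ oneTo n

-- i-th entry (0-based)
_‼_ : List ℕ → ℕ → Maybe ℕ
[] ‼ _ = nothing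
(x ∷ xs) ‼ zero = just x
(x ∷ xs) ‼ suc i = xs ‼ i

OrderIso : List ℕ → List ℕ → Set
OrderIso xs ys =
  length xs ≡ length ys ×
  (∀ i j a b c d → xs ‼ i ≡ just a → xs ‼ j ≡ just b →
                   ys ‼ i ≡ just c → ys ‼ j ≡ just d →
                   (a < b ⇔ c < d))

SquareAt : List ℕ → ℕ → ℕ → Set
SquareAt σ i k =
  2 ≤ k × i + (k + k) ≤ length σ ×
  OrderIso (take k (drop i σ)) (take k (drop (i + k) σ))

HasSquareOfLength : List ℕ → ℕ → Set
HasSquareOfLength σ L = ∃[ i ] ∃[ k ] (L ≡ k + k × SquareAt σ i k)

HasSquare : List ℕ → Set
HasSquare σ = ∃[ L ] HasSquareOfLength σ L

SquareFree : List ℕ → Set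
SquareFree σ = ¬ HasSquare σ

extendLeft : ℕ → List ℕ → List ℕ
extendLeft x π = x ∷ map (λ p → if p <ᵇ x then p else suc p) π

LeftCrucial : ℕ → List ℕ → Set
LeftCrucial n π =
  SquareFree π × (∀ x → 1 ≤ x → x ≤ suc n → HasSquare (extendLeft x π))

ExtensionSquareLength : ℕ → List ℕ → ℕ → Set
ExtensionSquareLength n π L =
  ∃[ x ] (1 ≤ x × x ≤ suc n × HasSquareOfLength (extendLeft x π) L)

-- Since π is square-free, every square of an extension xπ′ is a prefix of it.  Comparing the
-- two halves of a prefix square of half-length k entry by entry shows that x ≤ π_j holds iff
-- π_k < π_(k+j), for 1 ≤ j < k.  So extensions by values x ≤ π_j < y cannot have prefix squares
-- of the same half-length k > j.
--
-- If π_1 < π_2 < π_3 (the decreasing case is the mirror image), the extension by 1 has the square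
-- 1π′_1π′_2π′_3 of length 4.  The extensions by π_1 + 1, π_2 + 1 and n + 1 have no square of
-- length 4 (its first half would descend while π_2 < π_3), the one by n + 1 none of length 6
-- either (π_2π_3π_4π_5 would be a square of π), and separating them at π_2 and π_3 shows that
-- their half-lengths are pairwise distinct: four different lengths.

module Submission where

open import Defs
open import Data.Nat using (ℕ; zero; suc; _+_; _<_; _>_; _≤_; z≤n; s≤s; s≤s⁻¹; z<s; _<ᵇ_)
open import Data.Nat.Properties
open import Data.List using (List; []; _∷_; length; take; drop; map)
open import Data.List.Properties using (length-map; take-map; drop-map)
open import Data.List.Membership.Propositional using (_∈_)
open import Data.List.Membership.Propositional.Properties using (∈-map⁻; ∈-upTo⁻)
open import Data.List.Relation.Binary.Permutation.Propositional.Properties using (∈-resp-↭)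
open import Data.List.Relation.Unary.Any using (here; there)
open import Data.Maybe using (just)
open import Data.Bool using (true; false; if_then_else_)
open import Data.Product using (_×_; _,_; ∃-syntax; proj₁; proj₂)
open import Data.Sum using (_⊎_; inj₁; inj₂)
open import Data.Empty using (⊥-elim)
open import Data.Unit using (tt)
open import Function using (_∘_; _$_; const)
open import Function.Bundles using (_⇔_; mk⇔; Equivalence)
open import Function.Properties.Equivalence using () renaming (sym to ⇔-sym; trans to ⇔-trans)
open import Relation.Nullary using (¬_; yes; no)
open import Relation.Binary.Definitions using (tri<; tri≈; tri>)
open import Relation.Binary.PropositionalEquality using (_≡_; _≢_; refl; sym; trans; subst; subst₂; cong)

open Equivalence using (to; from)


-- extendLeft x π is definitionally x ∷ map (bump x) π.
bump : ℕ → ℕ → ℕ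
bump x p = if p <ᵇ x then p else suc p

bump-< : ∀ {x p} → p < x → bump x p ≡ p
bump-< {x} {p} p<x with p <ᵇ x | <⇒<ᵇ p<x
... | true | _ = refl

bump-≥ : ∀ {x p} → x ≤ p → bump x p ≡ suc p
bump-≥ {x} {p} x≤p with p <ᵇ x | <ᵇ⇒< p x
... | true  | p<x = ⊥-elim (<⇒≱ (p<x tt) x≤p)
... | false | _   = refl

bump-<-self : ∀ {x p} → p < x → bump x p < x
bump-<-self p<x rewrite bump-< p<x = p<x

self-<-bump : ∀ {x p} → x ≤ p → x < bump x p
self-<-bump x≤p rewrite bump-≥ x≤p = s≤s x≤p

self-<-bump⇔ : ∀ {x p} → x < bump x p ⇔ x ≤ p
self-<-bump⇔ {x} {p} = mk⇔ to′ self-<-bump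
  where
  to′ : x < bump x p → x ≤ p
  to′ x<b with <-cmp p x
  ... | tri< p<x _ _ = ⊥-elim (<-asym x<b (bump-<-self p<x))
  ... | tri≈ _ p≡x _ = subst (x ≤_) (sym p≡x) ≤-refl
  ... | tri> _ _ x<p = <⇒≤ x<p

bump-mono-< : ∀ {x p q} → p < q → bump x p < bump x q
bump-mono-< {x} {p} {q} p<q with p <? x | q <? x
... | yes p<x | yes q<x rewrite bump-< p<x | bump-< q<x = p<q
... | yes p<x | no q≮x  rewrite bump-< p<x | bump-≥ (≮⇒≥ q≮x) = m<n⇒m<1+n p<q
... | no p≮x  | yes q<x = ⊥-elim (<-asym q<x (≤-<-trans (≮⇒≥ p≮x) p<q))
... | no p≮x  | no q≮x  rewrite bump-≥ (≮⇒≥ p≮x) | bump-≥ (≮⇒≥ q≮x) = s≤s p<q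

bump-<-bump⇔ : ∀ x {p q} → bump x p < bump x q ⇔ p < q
bump-<-bump⇔ x {p} {q} = mk⇔ reflect (bump-mono-< {x})
  where
  reflect : bump x p < bump x q → p < q
  reflect b<b with <-cmp p q
  ... | tri< p<q _ _ = p<q
  ... | tri≈ _ refl _ = ⊥-elim (<-irrefl refl b<b)
  ... | tri> _ _ q<p = ⊥-elim (<-asym b<b (bump-mono-< {x} q<p))

‼-defined : ∀ (xs : List ℕ) {i} → i < length xs → ∃[ p ] (xs ‼ i ≡ just p)
‼-defined (x ∷ xs) {zero}  _         = x , refl
‼-defined (x ∷ xs) {suc i} (s≤s i<n) = ‼-defined xs i<n

‼-map : ∀ (f : ℕ → ℕ) (xs : List ℕ) {i p} → xs ‼ i ≡ just p → map f xs ‼ i ≡ just (f p)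
‼-map f (x ∷ xs) {zero}  refl = refl
‼-map f (x ∷ xs) {suc i} e    = ‼-map f xs e

‼-window : ∀ (xs : List ℕ) s {k i} → i < k → take k (drop s xs) ‼ i ≡ xs ‼ (s + i)
‼-window []       zero    {suc k} {i}     _         = refl
‼-window []       (suc s) {suc k} {i}     _         = refl
‼-window (x ∷ xs) zero    {suc k} {zero}  _         = refl
‼-window (x ∷ xs) zero    {suc k} {suc i} (s≤s i<k) = ‼-window xs zero i<k
‼-window (x ∷ xs) (suc s) {k}     {i}     i<k       = ‼-window xs s i<k

square-order : ∀ {σ s k i j u v p q} → SquareAt σ s k → i < k → j < k →
  σ ‼ (s + i) ≡ just u → σ ‼ (s + j) ≡ just v →
  σ ‼ (s + k + i) ≡ just p → σ ‼ (s + k + j) ≡ just q → (u < v ⇔ p < q)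
square-order {σ} {s} {k} (_ , _ , _ , iso) i<k j<k eu ev ep eq =
  iso _ _ _ _ _ _ (trans (‼-window σ s i<k) eu) (trans (‼-window σ s j<k) ev)
                  (trans (‼-window σ (s + k) i<k) ep) (trans (‼-window σ (s + k) j<k) eq)

SameDirection : ℕ → ℕ → ℕ → ℕ → Set
SameDirection u v w z = (u < v × w < z) ⊎ (v < u × z < w)

same-direction-⇔ : ∀ {u v w z} → SameDirection u v w z → (u < v ⇔ w < z)
same-direction-⇔ (inj₁ (u<v , w<z)) = mk⇔ (const w<z) (const u<v)
same-direction-⇔ (inj₂ (v<u , z<w)) = mk⇔ (⊥-elim ∘ <-asym v<u) (⊥-elim ∘ <-asym z<w)

same-direction-swap : ∀ {u v w z} → SameDirection u v w z → SameDirection v u z w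
same-direction-swap (inj₁ up)   = inj₂ up
same-direction-swap (inj₂ down) = inj₁ down

orderIso-pair : ∀ {u v w z} → SameDirection u v w z → OrderIso (u ∷ v ∷ []) (w ∷ z ∷ [])
orderIso-pair dir = refl , λ where
  0 0 _ _ _ _ refl refl refl refl → mk⇔ (⊥-elim ∘ <-irrefl refl) (⊥-elim ∘ <-irrefl refl)
  0 1 _ _ _ _ refl refl refl refl → same-direction-⇔ dir
  1 0 _ _ _ _ refl refl refl refl → same-direction-⇔ (same-direction-swap dir)
  1 1 _ _ _ _ refl refl refl refl → mk⇔ (⊥-elim ∘ <-irrefl refl) (⊥-elim ∘ <-irrefl refl)
  0 (suc (suc _)) _ _ _ _ _ () _ _
  1 (suc (suc _)) _ _ _ _ _ () _ _
  (suc (suc _)) _ _ _ _ _ () _ _ _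

orderIso-unmap : ∀ (f : ℕ → ℕ) → (∀ {p q} → f p < f q ⇔ p < q) →
  ∀ A B → OrderIso (map f A) (map f B) → OrderIso A B
orderIso-unmap f f-< A B (len , iso) =
  trans (sym (length-map f A)) (trans len (length-map f B)) ,
  λ i j a b c d ea eb ec ed →
    ⇔-trans (⇔-sym f-<)
      (⇔-trans (iso i j _ _ _ _ (‼-map f A ea) (‼-map f A eb) (‼-map f B ec) (‼-map f B ed)) f-<)

record PrefixSquare (x : ℕ) (π : List ℕ) (k : ℕ) : Set where
  constructor prefix-square
  field square : SquareAt (extendLeft x π) 0 k

square-of-extension-is-prefix : ∀ {x π L} → SquareFree π → HasSquareOfLength (extendLeft x π) L →
  ∃[ k ] (L ≡ k + k × PrefixSquare x π k)
square-of-extension-is-prefix         sf (zero  , k , L≡ , sq)               = k , L≡ , prefix-square sq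
square-of-extension-is-prefix {x} {π} sf (suc i , k , _  , 2≤k , fits , iso) =
  ⊥-elim (sf (k + k , i , k , refl , 2≤k , fits′ ,
              orderIso-unmap (bump x) (bump-<-bump⇔ x) (take k (drop i π)) (take k (drop (i + k) π)) iso′))
  where
  fits′ : i + (k + k) ≤ length π
  fits′ = subst (i + (k + k) ≤_) (length-map (bump x) π) (s≤s⁻¹ fits)
  window-map : ∀ s → take k (drop s (map (bump x) π)) ≡ map (bump x) (take k (drop s π))
  window-map s = trans (cong (take k) (drop-map s π)) (take-map k (drop s π))
  iso′ : OrderIso (map (bump x) (take k (drop i π))) (map (bump x) (take k (drop (i + k) π)))
  iso′ = subst₂ OrderIso (window-map i) (window-map (i + k)) iso

prefix-square-fits : ∀ {x π m} → PrefixSquare x π (suc m) → m + suc m ≤ length π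
prefix-square-fits {x} {π} (prefix-square (_ , fits , _)) =
  subst (_ ≤_) (length-map (bump x) π) (s≤s⁻¹ fits)

prefix-square-head-order : ∀ {x π m i p r q} → PrefixSquare x π (suc m) → suc i < suc m →
  π ‼ i ≡ just p → π ‼ m ≡ just r → π ‼ (m + suc i) ≡ just q → (x ≤ p ⇔ r < q)
prefix-square-head-order {x} {π} {m} {r = r} (prefix-square sq) i<m ep er eq =
  ⇔-trans (⇔-sym self-<-bump⇔)
    (⇔-trans (square-order {extendLeft x π} {0} {suc m} sq (s≤s z≤n) i<m
                refl (‼-map (bump x) π ep) (‼-map (bump x) π er′) (‼-map (bump x) π eq))
             (bump-<-bump⇔ x))
  where
  er′ : π ‼ (m + 0) ≡ just r
  er′ = subst (λ t → π ‼ t ≡ just r) (sym (+-identityʳ m)) er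

prefix-square-tail-order : ∀ {x π m i j p p′ q q′} → PrefixSquare x π (suc m) →
  suc i < suc m → suc j < suc m → π ‼ i ≡ just p → π ‼ j ≡ just p′ →
  π ‼ (m + suc i) ≡ just q → π ‼ (m + suc j) ≡ just q′ → (p < p′ ⇔ q < q′)
prefix-square-tail-order {x} {π} {m} (prefix-square sq) i<m j<m ep ep′ eq eq′ =
  ⇔-trans (⇔-sym (bump-<-bump⇔ x))
    (⇔-trans (square-order {extendLeft x π} {0} {suc m} sq i<m j<m
                (‼-map (bump x) π ep) (‼-map (bump x) π ep′) (‼-map (bump x) π eq) (‼-map (bump x) π eq′))
             (bump-<-bump⇔ x))

prefix-squares-agree : ∀ {x y π k} i {p} → PrefixSquare x π k → PrefixSquare y π k → suc i < k →
  π ‼ i ≡ just p → (x ≤ p ⇔ y ≤ p)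
prefix-squares-agree {π = π} {k = suc m} i sx sy i<k ep
  with ‼-defined π (<-≤-trans (m<m+n m z<s) (prefix-square-fits sx))
     | ‼-defined π (<-≤-trans (+-monoʳ-< m i<k) (prefix-square-fits sx))
... | r , er | q , eq =
  ⇔-trans (prefix-square-head-order sx i<k ep er eq) (⇔-sym (prefix-square-head-order sy i<k ep er eq))

half-exceeds : ∀ {x π h k} → h ≤ k → PrefixSquare x π k → ¬ PrefixSquare x π h → h < k
half-exceeds h≤k sq no-h = ≤∧≢⇒< h≤k (λ { refl → no-h sq })

prefix-square-length : ∀ {n π x k} → 1 ≤ x → x ≤ suc n → PrefixSquare x π k →
  ExtensionSquareLength n π (k + k)
prefix-square-length {x = x} {k} 1≤x x≤n+1 (prefix-square sq) = x , 1≤x , x≤n+1 , 0 , k , refl , sq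

LongHalf : ℕ → List ℕ → ℕ → Set
LongHalf n π k = 2 < k × ExtensionSquareLength n π (k + k)

LongPrefixSquare : ℕ → List ℕ → ℕ → Set
LongPrefixSquare n π x = ∃[ k ] (PrefixSquare x π k × LongHalf n π k)

long-prefix-square : ∀ {n π x} → LeftCrucial n π → 1 ≤ x → x ≤ suc n → ¬ PrefixSquare x π 2 →
  LongPrefixSquare n π x
long-prefix-square {x = x} (sf , crucial) 1≤x x≤n+1 no-2 with crucial x 1≤x x≤n+1
... | _ , square with square-of-extension-is-prefix sf square
... | k , _ , sq =
  k , sq , half-exceeds (proj₁ (PrefixSquare.square sq)) sq no-2 , prefix-square-length 1≤x x≤n+1 sq

straddle : ∀ {x y p} → x ≤ p → p < y → ¬ (x ≤ p ⇔ y ≤ p)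
straddle x≤p p<y agree = <⇒≱ p<y (to agree x≤p)

perm-entry-bounds : ∀ {n π p} → IsPerm n π → p ∈ π → 1 ≤ p × p ≤ n
perm-entry-bounds perm p∈π with ∈-map⁻ suc (∈-resp-↭ perm p∈π)
... | _ , q∈upTo , refl = s≤s z≤n , ∈-upTo⁻ q∈upTo

prefix-square-2 : ∀ {x a b c rest} → SameDirection x (bump x a) (bump x b) (bump x c) →
  PrefixSquare x (a ∷ b ∷ c ∷ rest) 2
prefix-square-2 dir = prefix-square $ s≤s (s≤s z≤n) , s≤s (s≤s (s≤s (s≤s z≤n))) , orderIso-pair dir

prefix-square-2-⇔ : ∀ {x a b c rest} → PrefixSquare x (a ∷ b ∷ c ∷ rest) 2 → (x ≤ a ⇔ b < c)
prefix-square-2-⇔ sq = prefix-square-head-order sq (s≤s (s≤s z≤n)) refl refl refl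

no-prefix-square-3 : ∀ {x a b c rest} → SquareFree (a ∷ b ∷ c ∷ rest) → SameDirection a b b c →
  ¬ PrefixSquare x (a ∷ b ∷ c ∷ rest) 3
no-prefix-square-3 {rest = []}     _ _ (prefix-square (_ , s≤s (s≤s (s≤s (s≤s ()))) , _))
no-prefix-square-3 {rest = _ ∷ []} _ _ (prefix-square (_ , s≤s (s≤s (s≤s (s≤s (s≤s ())))) , _))
no-prefix-square-3 {a = a} {b} {c} {d ∷ e ∷ _} sf dir sq =
  -- d e must repeat the pattern of a b, so b c d e is a square of length 4 in π.
  sf (4 , 1 , 2 , refl , ≤-refl , s≤s (s≤s (s≤s (s≤s (s≤s z≤n)))) , orderIso-pair (continue dir))
  where
  1<3 : 1 < 3
  1<3 = s≤s (s≤s z≤n)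
  2<3 : 2 < 3
  2<3 = s≤s (s≤s (s≤s z≤n))
  continue : SameDirection a b b c → SameDirection b c d e
  continue (inj₁ (a<b , b<c)) = inj₁ (b<c , to (prefix-square-tail-order sq 1<3 2<3 refl refl refl refl) a<b)
  continue (inj₂ (b<a , c<b)) = inj₂ (c<b , to (prefix-square-tail-order sq 2<3 1<3 refl refl refl refl) b<a)

ThreeDistinct : (ℕ → Set) → Set
ThreeDistinct P = ∃[ a ] ∃[ b ] ∃[ c ] (a ≢ b × a ≢ c × b ≢ c × P a × P b × P c)

ThreeAscending : (ℕ → Set) → Set
ThreeAscending P = ∃[ a ] ∃[ b ] ∃[ c ] (a < b × b < c × P a × P b × P c)

sort-three : ∀ {P} → ThreeDistinct P → ThreeAscending P
sort-three (a , b , c , a≢b , a≢c , b≢c , pa , pb , pc) with <-cmp a b | <-cmp a c | <-cmp b c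
... | tri≈ _ a≡b _ | _ | _ = ⊥-elim (a≢b a≡b)
... | _ | tri≈ _ a≡c _ | _ = ⊥-elim (a≢c a≡c)
... | _ | _ | tri≈ _ b≡c _ = ⊥-elim (b≢c b≡c)
... | tri< a<b _ _ | _            | tri< b<c _ _ = a , b , c , a<b , b<c , pa , pb , pc
... | tri< a<b _ _ | tri< a<c _ _ | tri> _ _ c<b = a , c , b , a<c , c<b , pa , pc , pb
... | tri< a<b _ _ | tri> _ _ c<a | _            = c , a , b , c<a , a<b , pc , pa , pb
... | tri> _ _ b<a | tri< a<c _ _ | _            = b , a , c , b<a , a<c , pb , pa , pc
... | tri> _ _ b<a | tri> _ _ c<a | tri< b<c _ _ = b , c , a , b<c , c<a , pb , pc , pa
... | tri> _ _ b<a | _            | tri> _ _ c<b = c , b , a , c<b , b<a , pc , pb , pa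

increasing-case : ∀ {n a b c rest} → let π = a ∷ b ∷ c ∷ rest in
  IsPerm n π → LeftCrucial n π → a < b → b < c →
  ExtensionSquareLength n π 4 × ThreeDistinct (LongHalf n π)
increasing-case {n} {a} {b} {c} {rest} perm lc a<b b<c =
  prefix-square-length ≤-refl (s≤s z≤n)
    (prefix-square-2 (inj₁ (self-<-bump 1≤a , bump-mono-< {1} b<c))) ,
  distinct (long-prefix-square lc (s≤s z≤n) (s≤s a≤n) (no-square-2 ≤-refl))
           (long-prefix-square lc (s≤s z≤n) (s≤s b≤n) (no-square-2 (m<n⇒m<1+n a<b)))
           (long-prefix-square lc (s≤s z≤n) ≤-refl (no-square-2 (s≤s a≤n)))
  where
  π = a ∷ b ∷ c ∷ rest
  1≤a = proj₁ (perm-entry-bounds perm (here refl))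
  a≤n = proj₂ (perm-entry-bounds perm (here refl))
  b≤n = proj₂ (perm-entry-bounds perm (there (here refl)))
  c≤n = proj₂ (perm-entry-bounds perm (there (there (here refl))))
  no-square-2 : ∀ {x} → a < x → ¬ PrefixSquare x π 2
  no-square-2 a<x sq = <⇒≱ a<x (from (prefix-square-2-⇔ sq) b<c)
  distinct : LongPrefixSquare n π (suc a) → LongPrefixSquare n π (suc b) → LongPrefixSquare n π (suc n) →
    ThreeDistinct (LongHalf n π)
  distinct (k₁ , s₁ , h₁) (k₂ , s₂ , h₂) (k₃ , s₃ , h₃) =
    k₁ , k₂ , k₃ , k₁≢k₂ , k₁≢k₃ , k₂≢k₃ , h₁ , h₂ , h₃
    where
    3<k₃ : 3 < k₃
    3<k₃ = half-exceeds (proj₁ h₃) s₃ (no-prefix-square-3 (proj₁ lc) (inj₁ (a<b , b<c)))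
    k₁≢k₂ : k₁ ≢ k₂
    k₁≢k₂ refl = straddle a<b ≤-refl (prefix-squares-agree 1 s₁ s₂ (proj₁ h₁) refl)
    k₁≢k₃ : k₁ ≢ k₃
    k₁≢k₃ refl = straddle a<b (s≤s b≤n) (prefix-squares-agree 1 s₁ s₃ (proj₁ h₁) refl)
    k₂≢k₃ : k₂ ≢ k₃
    k₂≢k₃ refl = straddle b<c (s≤s c≤n) (prefix-squares-agree 2 s₂ s₃ 3<k₃ refl)

decreasing-case : ∀ {n a b c rest} → let π = a ∷ b ∷ c ∷ rest in
  IsPerm n π → LeftCrucial n π → b < a → c < b →
  ExtensionSquareLength n π 4 × ThreeDistinct (LongHalf n π)
decreasing-case {n} {a} {b} {c} {rest} perm lc b<a c<b =
  prefix-square-length (s≤s z≤n) ≤-refl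
    (prefix-square-2 (inj₂ (bump-<-self (s≤s a≤n) , bump-mono-< {suc n} c<b))) ,
  distinct (long-prefix-square lc 1≤a (m≤n⇒m≤1+n a≤n) (no-square-2 ≤-refl))
           (long-prefix-square lc 1≤b (m≤n⇒m≤1+n b≤n) (no-square-2 (<⇒≤ b<a)))
           (long-prefix-square lc ≤-refl (s≤s z≤n) (no-square-2 1≤a))
  where
  π = a ∷ b ∷ c ∷ rest
  1≤a = proj₁ (perm-entry-bounds perm (here refl))
  a≤n = proj₂ (perm-entry-bounds perm (here refl))
  1≤b = proj₁ (perm-entry-bounds perm (there (here refl)))
  b≤n = proj₂ (perm-entry-bounds perm (there (here refl)))
  1≤c = proj₁ (perm-entry-bounds perm (there (there (here refl))))
  no-square-2 : ∀ {x} → x ≤ a → ¬ PrefixSquare x π 2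
  no-square-2 x≤a sq = <-asym c<b (to (prefix-square-2-⇔ sq) x≤a)
  distinct : LongPrefixSquare n π a → LongPrefixSquare n π b → LongPrefixSquare n π 1 →
    ThreeDistinct (LongHalf n π)
  distinct (k₁ , s₁ , h₁) (k₂ , s₂ , h₂) (k₃ , s₃ , h₃) =
    k₁ , k₂ , k₃ , k₁≢k₂ , k₁≢k₃ , k₂≢k₃ , h₁ , h₂ , h₃
    where
    3<k₃ : 3 < k₃
    3<k₃ = half-exceeds (proj₁ h₃) s₃ (no-prefix-square-3 (proj₁ lc) (inj₂ (b<a , c<b)))
    k₁≢k₂ : k₁ ≢ k₂
    k₁≢k₂ refl = straddle ≤-refl b<a (prefix-squares-agree 1 s₂ s₁ (proj₁ h₁) refl)
    k₁≢k₃ : k₁ ≢ k₃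
    k₁≢k₃ refl = straddle 1≤b b<a (prefix-squares-agree 1 s₃ s₁ (proj₁ h₁) refl)
    k₂≢k₃ : k₂ ≢ k₃
    k₂≢k₃ refl = straddle 1≤c c<b (prefix-squares-agree 2 s₃ s₂ 3<k₃ refl)

monotone-start-lengths : ∀ {n a b c rest} → let π = a ∷ b ∷ c ∷ rest in
  IsPerm n π → LeftCrucial n π → SameDirection a b b c →
  ExtensionSquareLength n π 4 × ThreeDistinct (LongHalf n π)
monotone-start-lengths perm lc (inj₁ (a<b , b<c)) = increasing-case perm lc a<b b<c
monotone-start-lengths perm lc (inj₂ (b<a , c<b)) = decreasing-case perm lc b<a c<b

proposition3 : (n : ℕ) (π : List ℕ) → IsPerm n π → LeftCrucial n π →
    ∃[ π₁ ] ∃[ π₂ ] ∃[ π₃ ] ∃[ rest ] (π ≡ π₁ ∷ π₂ ∷ π₃ ∷ rest × ((π₁ < π₂ × π₂ < π₃) ⊎ (π₁ > π₂ × π₂ > π₃))) →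
    ∃[ L₁ ] ∃[ L₂ ] ∃[ L₃ ] ∃[ L₄ ] (L₁ < L₂ × L₂ < L₃ × L₃ < L₄ ×
    ExtensionSquareLength n π L₁ × ExtensionSquareLength n π L₂ ×
    ExtensionSquareLength n π L₃ × ExtensionSquareLength n π L₄)
proposition3 n _ perm lc (_ , _ , _ , _ , refl , monotone)
  with monotone-start-lengths perm lc monotone
... | four , halves with sort-three halves
... | k₁ , k₂ , k₃ , k₁<k₂ , k₂<k₃ , (2<k₁ , len₁) , (_ , len₂) , (_ , len₃) =
  4 , k₁ + k₁ , k₂ + k₂ , k₃ + k₃ ,
  +-mono-< 2<k₁ 2<k₁ , +-mono-< k₁<k₂ k₁<k₂ , +-mono-< k₂<k₃ k₂<k₃ ,
  four , len₁ , len₂ , len₃
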